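{- Let $L=\{0110,1001\}$. Then $\mathcal{G}_L$ is exactly the class of permutation graphs.
   Context: All graphs are finite, simple, undirected, with nonempty vertex sets, and graph classes are considered up to isomorphism. A graph $G=([n],E)$ is a permutation graph if there is a bijection $\pi:[n]\to[n]$ such that for all distinct $i,j$: $\{i,j\}\in E$ iff $(i-j)(\pi(i)-\pi(j))<0$; a graph is a permutation graph if it is isomorphic to such a graph. For an alphabet $V$ and distinct $u,v\in V$, $h_{u,v}:V^*\to\{0,1\}^*$ is the monoid morphism with $u\mapsto 0$, $v\mapsto 1$ and $x\mapsto\lambda$ (empty word) for all other letters $x$. For a language $L\subseteq\{0,1\}^*$ closed under exchanging 0 and 1 and a nonempty word $w$ whose set of occurring letters is $V$, $G(L,w)$ is the graph with vertex set $V$ in which distinct $u,v$ are adjacent iff $h_{u,v}(w)\in L$. $\mathcal{G}_L$ is the class of all graphs isomorphic to some $G(L,w)$. -}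

module Defs where

open import Data.Nat using (ℕ; suc)
open import Data.Bool using (Bool; true; false)
open import Data.Fin using (Fin; _<_)
open import Data.Fin.Permutation using (Permutation; Permutation′; _⟨$⟩ʳ_)
open import Data.List using (List; []; _∷_)
open import Data.List.Membership.Propositional using (_∈_)
open import Data.Product using (Σ; ∃; ∃-syntax; _×_; _,_)
open import Data.Sum using (_⊎_)
open import Data.Empty using (⊥)
open import Relation.Nullary using (¬_)
open import Relation.Binary.PropositionalEquality using (_≡_; _≢_)
open import Function.Bundles using (_⇔_)
open import Level using (0ℓ)

record Graph (n : ℕ) : Set₁ where
  field
    Adj   : Fin n → Fin n → Set
    sym   : ∀ {i j} → Adj i j → Adj j i
    irrefl : ∀ {i} → ¬ Adj i i
open Graph public

_≅_ : ∀ {n m} → Graph n → Graph m → Set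
_≅_ {n} {m} G H = Σ (Permutation n m) λ f →
  ∀ i j → (Adj G i j ⇔ Adj H (f ⟨$⟩ʳ i) (f ⟨$⟩ʳ j))

-- {i,j} ∈ E iff (i - j)(π i - π j) < 0, i.e. the pair is an inversion of π.
PermAdj : ∀ {n} → Permutation′ n → Fin n → Fin n → Set
PermAdj π i j = (i < j × (π ⟨$⟩ʳ j) < (π ⟨$⟩ʳ i))
              ⊎ (j < i × (π ⟨$⟩ʳ i) < (π ⟨$⟩ʳ j))


open import Data.Fin.Properties using (<-asym; <-irrefl)
open import Data.Sum using (inj₁; inj₂)
open import Relation.Binary.PropositionalEquality using (refl)

permGraph : ∀ {n} → Permutation′ n → Graph n
permGraph π = record
  { Adj = PermAdj π
  ; sym = λ { (inj₁ p) → inj₂ p ; (inj₂ p) → inj₁ p }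
  ; irrefl = λ { (inj₁ (p , _)) → <-irrefl refl p ; (inj₂ (p , _)) → <-irrefl refl p }
  }

IsPermutationGraph : ∀ {n} → Graph n → Set
IsPermutationGraph {n} G = ∃[ π ] (G ≅ permGraph {n} π)

-- Letter images of h_{u,v}: u ↦ 0 (false), v ↦ 1 (true), others ↦ λ.
hLetter : ∀ {m} → Fin m → Fin m → Fin m → List Bool → List Bool
hLetter u v x rest with x Data.Fin.≟ u | x Data.Fin.≟ v
... | Relation.Nullary.yes _ | _ = false ∷ rest
... | Relation.Nullary.no _  | Relation.Nullary.yes _ = true ∷ rest
... | Relation.Nullary.no _  | Relation.Nullary.no _  = rest

h : ∀ {m} → Fin m → Fin m → List (Fin m) → List Bool
h u v [] = []
h u v (x ∷ w) = hLetter u v x (h u v w)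

Language : Set₁
Language = List Bool → Set

L : Language
L b = (b ≡ false ∷ true ∷ true ∷ false ∷ []) ⊎ (b ≡ true ∷ false ∷ false ∷ true ∷ [])

ClosedUnderExchange : Language → Set
ClosedUnderExchange L' = ∀ b → L' b → L' (Data.List.map Data.Bool.not b)

-- G(L,w) for a word w over the alphabet Fin m in which every letter occurs
-- (so the set of occurring letters, the vertex set, is Fin m).
wordGraph : ∀ {m} (L' : Language) → ClosedUnderExchange L' → List (Fin m) → Graph m
wordGraph {m} L' cl w = record
  { Adj = λ u v → u ≢ v × L' (h u v w)
  ; sym = λ { {u} {v} (u≢v , p) → (λ e → u≢v (Relation.Binary.PropositionalEquality.sym e)) , swapLemma u v u≢v p }
  ; irrefl = λ { (u≢u , _) → u≢u refl }
  }
  where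
  open import Data.List.Properties using (map-cong)
  hLetterSwap : ∀ u v → u ≢ v → ∀ x rest →
    hLetter v u x (Data.List.map Data.Bool.not rest) ≡ Data.List.map Data.Bool.not (hLetter u v x rest)
  hLetterSwap u v u≢v x rest with x Data.Fin.≟ u | x Data.Fin.≟ v
  ... | Relation.Nullary.yes refl | Relation.Nullary.yes refl with () ← u≢v refl
  ... | Relation.Nullary.yes refl | Relation.Nullary.no _ = refl
  ... | Relation.Nullary.no _ | Relation.Nullary.yes refl = refl
  ... | Relation.Nullary.no _ | Relation.Nullary.no _ = refl
  hSwap : ∀ u v → u ≢ v → ∀ w' → h v u w' ≡ Data.List.map Data.Bool.not (h u v w')
  hSwap u v u≢v [] = refl
  hSwap u v u≢v (x ∷ w') rewrite hSwap u v u≢v w' = hLetterSwap u v u≢v x (h u v w')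
  swapLemma : ∀ u v → u ≢ v → L' (h u v w) → L' (h v u w)
  swapLemma u v u≢v p rewrite hSwap u v u≢v w = cl _ p

L-closed : ClosedUnderExchange L
L-closed _ (inj₁ refl) = inj₂ refl
L-closed _ (inj₂ refl) = inj₁ refl

In𝒢 : (L' : Language) → ClosedUnderExchange L' → ∀ {n} → Graph n → Set
In𝒢 L' cl {n} G = ∃[ m ] Σ (List (Fin m)) λ w →
  (w ≢ []) × (∀ (x : Fin m) → x ∈ w) × (G ≅ wordGraph L' cl w)

-- For distinct letters u, v of w, the word h_{u,v}(w) lies in L = {0110, 1001} exactly when u
-- and v both occur twice in w and the occurrences of one enclose those of the other, that is,
-- when the order of first occurrences and the order of last occurrences disagree on u, v.
-- So G(L,w) is the graph of inversions between two linear orders of its vertices, the letters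
-- that do not occur twice being isolated; ranking both orders turns it into a permutation graph.
-- Conversely, for a permutation π the word 0 1 … n−1 π⁻¹(0) π⁻¹(1) … π⁻¹(n−1) is sent by h_{i,j}
-- to 01·10 or 10·01 exactly when π inverts i and j, and otherwise to 01·01 or 10·10.
module Submission where

open import Defs hiding (sym)
open import Data.Nat as ℕ using (ℕ; zero; suc; _+_; _∸_; z≤n; s≤s)
import Data.Nat.Properties as ℕP
open import Data.Bool as B using (Bool; true; false; not)
open import Data.Fin as F using (Fin; toℕ; fromℕ<; punchOut)
import Data.Fin.Properties as FP
open import Data.Fin.Permutation
  using (Permutation′; _⟨$⟩ʳ_; _⟨$⟩ˡ_; permutation; inverseˡ; _∘ₚ_; flip; ↔⇒≡)
import Data.Fin.Permutation as Perm
open import Data.List using (List; []; _∷_; _++_; [_]; reverse; length; tabulate; allFin)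
open import Data.List.Properties using (unfold-reverse; reverse-++; length-reverse)
open import Data.List.Relation.Unary.All using (All; []; _∷_)
import Data.List.Relation.Unary.All as All
open import Data.List.Relation.Unary.AllPairs using (_∷_)
open import Data.List.Relation.Unary.Any using (here; there)
import Data.List.Relation.Unary.Any.Properties as Any
open import Data.List.Relation.Unary.Unique.Propositional using (Unique)
open import Data.List.Relation.Unary.Unique.Propositional.Properties using (tabulate⁺)
open import Data.List.Membership.Propositional using (_∈_)
open import Data.List.Membership.Propositional.Properties using (∈-tabulate⁺; ∈-allFin; ∈-++⁺ˡ)
open import Data.Product using (∃; _×_; _,_; proj₁; proj₂; uncurry)
open import Data.Sum using (_⊎_; inj₁; inj₂)
open import Data.Empty using (⊥-elim)
open import Function using (_∘_; id)
open import Function.Bundles using (_⇔_; mk⇔; Equivalence; Injection)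
open import Function.Construct.Composition using (_⇔-∘_)
open import Function.Construct.Symmetry using (⇔-sym)
open import Function.Definitions using (Injective)
open import Function.Properties.Inverse using (↔⇒↣)
open import Relation.Nullary using (¬_; yes; no)
open import Relation.Nullary.Decidable using (decidable-stable)
open import Relation.Nullary.Negation using (contradiction)
open import Relation.Unary using (Decidable)
open import Relation.Binary.Definitions using (DecidableEquality; tri<; tri≈; tri>)
open import Relation.Binary.PropositionalEquality hiding ([_])

≅-trans : ∀ {n m o} {G : Graph n} {H : Graph m} {K : Graph o} → G ≅ H → H ≅ K → G ≅ K
≅-trans (f , f-iso) (g , g-iso) = f ∘ₚ g , λ i j → g-iso (f ⟨$⟩ʳ i) (f ⟨$⟩ʳ j) ⇔-∘ f-iso i j

isPermutationGraph-resp-≅ : ∀ {n m} {G : Graph n} {H : Graph m} →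
  G ≅ H → IsPermutationGraph H → IsPermutationGraph G
isPermutationGraph-resp-≅ {G = G} {H = H} G≅H (π , H≅π) with refl ← ↔⇒≡ (proj₁ G≅H) =
  π , ≅-trans {G = G} {H = H} {K = permGraph π} G≅H H≅π

injective⇒surjective : ∀ {n} {f : Fin n → Fin n} → Injective _≡_ _≡_ f → ∀ y → ∃ λ x → f x ≡ y
injective⇒surjective {suc n} {f} f-injective y with FP.any? (λ x → f x F.≟ y)
... | yes hit = hit
... | no miss = contradiction (FP.injective⇒≤ g-injective) ℕP.1+n≰n
  where
  g : Fin (suc n) → Fin n
  g x = punchOut (miss ∘ (x ,_) ∘ sym)
  g-injective : Injective _≡_ _≡_ g
  g-injective = f-injective ∘ FP.punchOut-injective {i = y} _ _

injective⇒permutation : ∀ {n} (f : Fin n → Fin n) → Injective _≡_ _≡_ f → Permutation′ n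
injective⇒permutation f f-injective = permutation f (proj₁ ∘ surj) (proj₂ ∘ surj)
  (λ x → f-injective (proj₂ (surj (f x))))
  where surj = injective⇒surjective f-injective

countBelow : ∀ {n} → (Fin n → ℕ) → ℕ → ℕ
countBelow {zero}  k a = 0
countBelow {suc n} k a with k F.zero ℕ.<? a
... | yes _ = suc (countBelow (k ∘ F.suc) a)
... | no _  = countBelow (k ∘ F.suc) a

countBelow-≤ : ∀ {n} (k : Fin n → ℕ) a → countBelow k a ℕ.≤ n
countBelow-≤ {zero}  k a = z≤n
countBelow-≤ {suc n} k a with k F.zero ℕ.<? a
... | yes _ = s≤s (countBelow-≤ (k ∘ F.suc) a)
... | no _  = ℕP.m≤n⇒m≤1+n (countBelow-≤ (k ∘ F.suc) a)

countBelow-mono-≤ : ∀ {n} (k : Fin n → ℕ) {a b} → a ℕ.≤ b → countBelow k a ℕ.≤ countBelow k b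
countBelow-mono-≤ {zero}  k a≤b = z≤n
countBelow-mono-≤ {suc n} k {a} {b} a≤b with k F.zero ℕ.<? a | k F.zero ℕ.<? b
... | yes _   | yes _  = s≤s (countBelow-mono-≤ (k ∘ F.suc) a≤b)
... | yes k<a | no k≮b = contradiction (ℕP.<-≤-trans k<a a≤b) k≮b
... | no _    | yes _  = ℕP.m≤n⇒m≤1+n (countBelow-mono-≤ (k ∘ F.suc) a≤b)
... | no _    | no _   = countBelow-mono-≤ (k ∘ F.suc) a≤b

countBelow-mono-< : ∀ {n} (k : Fin n → ℕ) {a b} (x : Fin n) →
  a ℕ.≤ k x → k x ℕ.< b → countBelow k a ℕ.< countBelow k b
countBelow-mono-< {suc n} k {a} {b} x a≤kx kx<b with k F.zero ℕ.<? a | k F.zero ℕ.<? b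
countBelow-mono-< k F.zero    a≤kx kx<b | yes k<a | _      = contradiction a≤kx (ℕP.<⇒≱ k<a)
countBelow-mono-< k F.zero    a≤kx kx<b | no _    | yes _  =
  s≤s (countBelow-mono-≤ (k ∘ F.suc) (ℕP.≤-trans a≤kx (ℕP.<⇒≤ kx<b)))
countBelow-mono-< k F.zero    a≤kx kx<b | no _    | no k≮b = contradiction kx<b k≮b
countBelow-mono-< k (F.suc x) a≤kx kx<b | yes _   | yes _  =
  s≤s (countBelow-mono-< (k ∘ F.suc) x a≤kx kx<b)
countBelow-mono-< k (F.suc x) a≤kx kx<b | yes k<a | no k≮b =
  contradiction (ℕP.<-trans k<a (ℕP.≤-<-trans a≤kx kx<b)) k≮b
countBelow-mono-< k (F.suc x) a≤kx kx<b | no _    | yes _  =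
  ℕP.m<n⇒m<1+n (countBelow-mono-< (k ∘ F.suc) x a≤kx kx<b)
countBelow-mono-< k (F.suc x) a≤kx kx<b | no _    | no _   = countBelow-mono-< (k ∘ F.suc) x a≤kx kx<b

module Rank {n} (k : Fin n → ℕ) (k-injective : Injective _≡_ _≡_ k) where

  rank : Fin n → Fin n
  rank x = fromℕ< {countBelow k (k x)} (ℕP.<-≤-trans
    (countBelow-mono-< k x ℕP.≤-refl (ℕP.n<1+n (k x))) (countBelow-≤ k (suc (k x))))

  toℕ-rank : ∀ x → toℕ (rank x) ≡ countBelow k (k x)
  toℕ-rank x = FP.toℕ-fromℕ< _

  rank-mono-< : ∀ {x y} → k x ℕ.< k y → rank x F.< rank y
  rank-mono-< {x} {y} kx<ky rewrite toℕ-rank x | toℕ-rank y = countBelow-mono-< k x ℕP.≤-refl kx<ky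

  rank-cancel-< : ∀ {x y} → rank x F.< rank y → k x ℕ.< k y
  rank-cancel-< {x} {y} rx<ry with ℕP.<-cmp (k x) (k y)
  ... | tri< kx<ky _ _ = kx<ky
  ... | tri≈ _ kx≡ky _ rewrite k-injective kx≡ky = contradiction rx<ry (ℕP.<-irrefl refl)
  ... | tri> _ _ ky<kx = contradiction (rank-mono-< ky<kx) (ℕP.<-asym rx<ry)

  rank-injective : Injective _≡_ _≡_ rank
  rank-injective {x} {y} rx≡ry with ℕP.<-cmp (k x) (k y)
  ... | tri< kx<ky _ _ = contradiction (cong toℕ rx≡ry) (ℕP.<⇒≢ (rank-mono-< kx<ky))
  ... | tri≈ _ kx≡ky _ = k-injective kx≡ky
  ... | tri> _ _ ky<kx = contradiction (cong toℕ (sym rx≡ry)) (ℕP.<⇒≢ (rank-mono-< ky<kx))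

  rank-<⇔ : ∀ x y → k x ℕ.< k y ⇔ rank x F.< rank y
  rank-<⇔ x y = mk⇔ rank-mono-< rank-cancel-<

  rankPermutation : Permutation′ n
  rankPermutation = injective⇒permutation rank rank-injective

Inversion : ∀ {n} → (Fin n → ℕ) → (Fin n → ℕ) → Fin n → Fin n → Set
Inversion k₁ k₂ x y = (k₁ x ℕ.< k₁ y × k₂ y ℕ.< k₂ x) ⊎ (k₁ y ℕ.< k₁ x × k₂ x ℕ.< k₂ y)

module _ {n} {k₁ k₂ : Fin n → ℕ} where

  Inversion-sym : ∀ {x y} → Inversion k₁ k₂ x y → Inversion k₁ k₂ y x
  Inversion-sym (inj₁ p) = inj₂ p
  Inversion-sym (inj₂ p) = inj₁ p

  Inversion-irrefl : ∀ {x} → ¬ Inversion k₁ k₂ x x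
  Inversion-irrefl (inj₁ (lt , _)) = ℕP.<-irrefl refl lt
  Inversion-irrefl (inj₂ (lt , _)) = ℕP.<-irrefl refl lt

  Inversion-resp-< : ∀ {l₁ l₂ : Fin n → ℕ} →
    (∀ x y → k₁ x ℕ.< k₁ y ⇔ l₁ x ℕ.< l₁ y) → (∀ x y → k₂ x ℕ.< k₂ y ⇔ l₂ x ℕ.< l₂ y) →
    ∀ x y → Inversion k₁ k₂ x y ⇔ Inversion l₁ l₂ x y
  Inversion-resp-< k₁≈l₁ k₂≈l₂ x y = mk⇔
    (λ { (inj₁ (p , q)) → inj₁ (to (k₁≈l₁ x y) p , to (k₂≈l₂ y x) q)
       ; (inj₂ (p , q)) → inj₂ (to (k₁≈l₁ y x) p , to (k₂≈l₂ x y) q) })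
    (λ { (inj₁ (p , q)) → inj₁ (from (k₁≈l₁ x y) p , from (k₂≈l₂ y x) q)
       ; (inj₂ (p , q)) → inj₂ (from (k₁≈l₁ y x) p , from (k₂≈l₂ x y) q) })
    where open Equivalence

-- PermAdj π is definitionally Inversion toℕ (toℕ ∘ (π ⟨$⟩ʳ_)).
PermAdj-conjugate : ∀ {n} (σ τ : Permutation′ n) x y →
  PermAdj (flip σ ∘ₚ τ) (σ ⟨$⟩ʳ x) (σ ⟨$⟩ʳ y) ≡ Inversion (toℕ ∘ (σ ⟨$⟩ʳ_)) (toℕ ∘ (τ ⟨$⟩ʳ_)) x y
PermAdj-conjugate σ τ x y rewrite inverseˡ σ {x} | inverseˡ σ {y} = refl

inversionGraph-isPermutationGraph : ∀ {n} {G : Graph n} (k₁ k₂ : Fin n → ℕ) →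
  Injective _≡_ _≡_ k₁ → Injective _≡_ _≡_ k₂ →
  (∀ x y → Adj G x y ⇔ Inversion k₁ k₂ x y) → IsPermutationGraph G
inversionGraph-isPermutationGraph {G = G} k₁ k₂ k₁-injective k₂-injective G⇔Inversion =
  flip ρ₁ ∘ₚ ρ₂ , ρ₁ , λ x y →
    subst (Adj G x y ⇔_) (sym (PermAdj-conjugate ρ₁ ρ₂ x y))
      (Inversion-resp-< R₁.rank-<⇔ R₂.rank-<⇔ x y ⇔-∘ G⇔Inversion x y)
  where
  module R₁ = Rank k₁ k₁-injective
  module R₂ = Rank k₂ k₂-injective
  ρ₁ = R₁.rankPermutation
  ρ₂ = R₂.rankPermutation

module Padding {m} {P : Fin m → Set} (P? : Decidable P) (B : ℕ) where

  pad : (Fin m → ℕ) → Fin m → ℕ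
  pad k x with P? x
  ... | yes _ = k x
  ... | no _  = B + toℕ x

  pad-injective : ∀ {k} → (∀ x → k x ℕ.< B) → Injective _≡_ _≡_ k → Injective _≡_ _≡_ (pad k)
  pad-injective {k} k<B k-injective {x} {y} eq with P? x | P? y
  ... | yes _ | yes _ = k-injective eq
  ... | yes _ | no _  = contradiction eq (ℕP.<⇒≢ (ℕP.<-≤-trans (k<B x) (ℕP.m≤m+n B (toℕ y))))
  ... | no _  | yes _ = contradiction (sym eq) (ℕP.<⇒≢ (ℕP.<-≤-trans (k<B y) (ℕP.m≤m+n B (toℕ x))))
  ... | no _  | no _  = FP.toℕ-injective (ℕP.+-cancelˡ-≡ B _ _ eq)

  module _ {k₁ k₂ : Fin m → ℕ} (k₁<B : ∀ x → k₁ x ℕ.< B) (k₂<B : ∀ x → k₂ x ℕ.< B) where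

    ¬Inversion-pad : ∀ {x y} → ¬ P x → ¬ Inversion (pad k₁) (pad k₂) x y
    ¬Inversion-pad {x} {y} ¬px with P? x
    ... | yes px = contradiction px ¬px
    ... | no _ with P? y
    ...   | yes _ = λ { (inj₁ (lt , _)) → ℕP.≤⇒≯ (ℕP.m≤m+n B (toℕ x)) (ℕP.<-trans lt (k₁<B y))
                      ; (inj₂ (_ , lt)) → ℕP.≤⇒≯ (ℕP.m≤m+n B (toℕ x)) (ℕP.<-trans lt (k₂<B y)) }
    ...   | no _  = λ { (inj₁ (lt , gt)) → ℕP.<-asym lt gt ; (inj₂ (gt , lt)) → ℕP.<-asym lt gt }

    Inversion-pad≡ : ∀ {x y} → P x → P y → Inversion (pad k₁) (pad k₂) x y ≡ Inversion k₁ k₂ x y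
    Inversion-pad≡ {x} {y} px py with P? x | P? y
    ... | yes _  | yes _  = refl
    ... | no ¬px | _      = contradiction px ¬px
    ... | _      | no ¬py = contradiction py ¬py

    Inversion-pad : ∀ x y → Inversion (pad k₁) (pad k₂) x y ⇔ (P x × P y × Inversion k₁ k₂ x y)
    Inversion-pad x y = mk⇔
      (λ inv → let px = decidable-stable (P? x) (λ ¬px → ¬Inversion-pad ¬px inv)
                   py = decidable-stable (P? y)
                          (λ ¬py → ¬Inversion-pad ¬py (Inversion-sym {k₁ = pad k₁} {pad k₂} inv))
               in px , py , subst id (Inversion-pad≡ px py) inv)
      (λ (px , py , inv) → subst id (sym (Inversion-pad≡ px py)) inv)

module Occurrences {A : Set} (_≟_ : DecidableEquality A) where

  count : A → List A → ℕ
  count x [] = 0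
  count x (y ∷ ys) with y ≟ x
  ... | yes _ = suc (count x ys)
  ... | no _  = count x ys

  firstIndex : A → List A → ℕ
  firstIndex x [] = 0
  firstIndex x (y ∷ ys) with y ≟ x
  ... | yes _ = 0
  ... | no _  = suc (firstIndex x ys)

  firstIndex-< : ∀ {x} xs → x ∈ xs → firstIndex x xs ℕ.< length xs
  firstIndex-< {x} (y ∷ ys) x∈ with y ≟ x
  firstIndex-< (y ∷ ys) x∈          | yes _  = s≤s z≤n
  firstIndex-< (y ∷ ys) (here refl) | no y≢x = contradiction refl y≢x
  firstIndex-< (y ∷ ys) (there x∈)  | no _   = s≤s (firstIndex-< ys x∈)

  firstIndex-injective : ∀ {x y xs} → x ∈ xs → y ∈ xs → firstIndex x xs ≡ firstIndex y xs → x ≡ y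
  firstIndex-injective {x} {y} {z ∷ zs} x∈ y∈ eq with z ≟ x | z ≟ y
  ... | yes refl | yes refl = refl
  ... | yes _    | no _     = contradiction eq λ ()
  ... | no _     | yes _    = contradiction eq λ ()
  firstIndex-injective (here refl) _ _          | no z≢x | no _   = contradiction refl z≢x
  firstIndex-injective _ (here refl) _          | no _   | no z≢y = contradiction refl z≢y
  firstIndex-injective (there x∈) (there y∈) eq | no _   | no _   =
    firstIndex-injective x∈ y∈ (ℕP.suc-injective eq)

  firstIndex-tabulate : ∀ {n} {f : Fin n → A} → Injective _≡_ _≡_ f →
    ∀ i → firstIndex (f i) (tabulate f) ≡ toℕ i
  firstIndex-tabulate {f = f} f-injective F.zero with f F.zero ≟ f F.zero
  ... | yes _  = refl
  ... | no f≢f = contradiction refl f≢f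
  firstIndex-tabulate {f = f} f-injective (F.suc i) with f F.zero ≟ f (F.suc i)
  ... | yes f0≡fi = contradiction (f-injective f0≡fi) λ ()
  ... | no _      = cong suc (firstIndex-tabulate (FP.suc-injective ∘ f-injective) i)

  count-∉ : ∀ {x xs} → All (x ≢_) xs → count x xs ≡ 0
  count-∉ [] = refl
  count-∉ {x} {y ∷ ys} (x≢y ∷ x∉) with y ≟ x
  ... | yes refl = contradiction refl x≢y
  ... | no _     = count-∉ x∉

  count-unique : ∀ {x xs} → Unique xs → x ∈ xs → count x xs ≡ 1
  count-unique {x} {x ∷ ys} (x∉ ∷ _) (here refl) with x ≟ x
  ... | yes _  = cong suc (count-∉ x∉)
  ... | no x≢x = contradiction refl x≢x
  count-unique {x} {y ∷ ys} (y∉ ∷ u) (there x∈) with y ≟ x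
  ... | yes refl = contradiction refl (All.lookup y∉ x∈)
  ... | no _     = count-unique u x∈

  count-tabulate : ∀ {n} {f : Fin n → A} → Injective _≡_ _≡_ f →
    ∀ i → count (f i) (tabulate f) ≡ 1
  count-tabulate f-injective i = count-unique (tabulate⁺ f-injective) (∈-tabulate⁺ i)

zeros ones : List Bool → ℕ
zeros = Occurrences.count B._≟_ false
ones  = Occurrences.count B._≟_ true

length≡zeros+ones : ∀ bs → length bs ≡ zeros bs + ones bs
length≡zeros+ones []           = refl
length≡zeros+ones (false ∷ bs) = cong suc (length≡zeros+ones bs)
length≡zeros+ones (true ∷ bs)  =
  trans (cong suc (length≡zeros+ones bs)) (sym (ℕP.+-suc (zeros bs) (ones bs)))

sole-letter : ∀ b bs →
  Occurrences.count B._≟_ (not b) bs ≡ 0 → Occurrences.count B._≟_ b bs ≡ 1 → bs ≡ b ∷ []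
sole-letter false (false ∷ [])        _ _  = refl
sole-letter false (false ∷ false ∷ _) _ ()
sole-letter false (false ∷ true ∷ _)  ()
sole-letter false (true ∷ _)          ()
sole-letter true  (true ∷ [])         _ _  = refl
sole-letter true  (true ∷ true ∷ _)   _ ()
sole-letter true  (true ∷ false ∷ _)  ()
sole-letter true  (false ∷ _)         ()
sole-letter b     []                  _ ()

shape₄ : ∀ {A : Set} (xs : List A) → length xs ≡ 4 →
  ∃ λ a → ∃ λ b → ∃ λ c → ∃ λ d → xs ≡ a ∷ b ∷ c ∷ d ∷ []
shape₄ (a ∷ b ∷ c ∷ d ∷ []) refl = a , b , c , d , refl

L-balanced : ∀ {bs} → L bs → zeros bs ≡ 2 × ones bs ≡ 2
L-balanced (inj₁ refl) = refl , refl
L-balanced (inj₂ refl) = refl , refl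

L-ends : ∀ {P₁ P₂ Q₁ Q₂ : Set} {bs} → ¬ (P₁ × P₂) → ¬ (Q₁ × Q₂) →
  (P₁ × ∃ λ cs → bs ≡ false ∷ cs) ⊎ (P₂ × ∃ λ cs → bs ≡ true ∷ cs) →
  (Q₁ × ∃ λ cs → reverse bs ≡ false ∷ cs) ⊎ (Q₂ × ∃ λ cs → reverse bs ≡ true ∷ cs) →
  zeros bs ≡ 2 → ones bs ≡ 2 → L bs ⇔ ((P₁ × Q₁) ⊎ (P₂ × Q₂))
L-ends {bs = bs} _ _ _ _ z o with shape₄ bs (trans (length≡zeros+ones bs) (cong₂ _+_ z o))
L-ends _ _ (inj₁ (p , _ , refl)) (inj₁ (q , _ , refl)) _ _ | _ , true , true , _ , refl =
  mk⇔ (λ _ → inj₁ (p , q)) (λ _ → inj₁ refl)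
L-ends _ _ (inj₂ (p , _ , refl)) (inj₂ (q , _ , refl)) _ _ | _ , false , false , _ , refl =
  mk⇔ (λ _ → inj₂ (p , q)) (λ _ → inj₂ refl)
L-ends ¬P ¬Q (inj₁ (p , _ , refl)) (inj₂ (q , _ , refl)) _ _ | _ , _ , _ , _ , refl =
  mk⇔ (λ { (inj₁ ()) ; (inj₂ ()) })
      (λ { (inj₁ (_ , q′)) → contradiction (q′ , q) ¬Q ; (inj₂ (p′ , _)) → contradiction (p , p′) ¬P })
L-ends ¬P ¬Q (inj₂ (p , _ , refl)) (inj₁ (q , _ , refl)) _ _ | _ , _ , _ , _ , refl =
  mk⇔ (λ { (inj₁ ()) ; (inj₂ ()) })
      (λ { (inj₁ (p′ , _)) → contradiction (p′ , p) ¬P ; (inj₂ (_ , q′)) → contradiction (q , q′) ¬Q })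
L-ends _ _ (inj₁ (_ , _ , refl)) (inj₁ (_ , _ , refl)) () _ | _ , false , false , _ , refl
L-ends _ _ (inj₁ (_ , _ , refl)) (inj₁ (_ , _ , refl)) () _ | _ , false , true  , _ , refl
L-ends _ _ (inj₁ (_ , _ , refl)) (inj₁ (_ , _ , refl)) () _ | _ , true  , false , _ , refl
L-ends _ _ (inj₂ (_ , _ , refl)) (inj₂ (_ , _ , refl)) _ () | _ , true  , true  , _ , refl
L-ends _ _ (inj₂ (_ , _ , refl)) (inj₂ (_ , _ , refl)) _ () | _ , true  , false , _ , refl
L-ends _ _ (inj₂ (_ , _ , refl)) (inj₂ (_ , _ , refl)) _ () | _ , false , true  , _ , refl

L-++-orders : ∀ {P₁ P₂ Q₁ Q₂ : Set} {bs cs} → ¬ (P₁ × P₂) → ¬ (Q₁ × Q₂) →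
  (P₁ × bs ≡ false ∷ true ∷ []) ⊎ (P₂ × bs ≡ true ∷ false ∷ []) →
  (Q₁ × cs ≡ false ∷ true ∷ []) ⊎ (Q₂ × cs ≡ true ∷ false ∷ []) →
  L (bs ++ cs) ⇔ ((P₁ × Q₂) ⊎ (P₂ × Q₁))
L-++-orders _ _ (inj₁ (p , refl)) (inj₂ (q , refl)) = mk⇔ (λ _ → inj₁ (p , q)) (λ _ → inj₁ refl)
L-++-orders _ _ (inj₂ (p , refl)) (inj₁ (q , refl)) = mk⇔ (λ _ → inj₂ (p , q)) (λ _ → inj₂ refl)
L-++-orders ¬P ¬Q (inj₁ (p , refl)) (inj₁ (q , refl)) = mk⇔ (λ { (inj₁ ()) ; (inj₂ ()) })
  λ { (inj₁ (_ , q′)) → contradiction (q , q′) ¬Q ; (inj₂ (p′ , _)) → contradiction (p , p′) ¬P }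
L-++-orders ¬P ¬Q (inj₂ (p , refl)) (inj₂ (q , refl)) = mk⇔ (λ { (inj₁ ()) ; (inj₂ ()) })
  λ { (inj₁ (p′ , _)) → contradiction (p′ , p) ¬P ; (inj₂ (_ , q′)) → contradiction (q′ , q) ¬Q }

open module LetterOccurrences {m} = Occurrences (F._≟_ {m})

module _ {m : ℕ} where

  hLetter-++ : ∀ (u v x : Fin m) bs cs → hLetter u v x (bs ++ cs) ≡ hLetter u v x bs ++ cs
  hLetter-++ u v x bs cs with x F.≟ u | x F.≟ v
  ... | yes _ | _     = refl
  ... | no _  | yes _ = refl
  ... | no _  | no _  = refl

  reverse-h[x] : ∀ (u v x : Fin m) → reverse (h u v [ x ]) ≡ h u v [ x ]
  reverse-h[x] u v x with x F.≟ u | x F.≟ v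
  ... | yes _ | _     = refl
  ... | no _  | yes _ = refl
  ... | no _  | no _  = refl

  h-++ : ∀ (u v : Fin m) xs ys → h u v (xs ++ ys) ≡ h u v xs ++ h u v ys
  h-++ u v []       ys = refl
  h-++ u v (x ∷ xs) ys =
    trans (cong (hLetter u v x) (h-++ u v xs ys)) (hLetter-++ u v x (h u v xs) (h u v ys))

  h-reverse : ∀ (u v : Fin m) w → h u v (reverse w) ≡ reverse (h u v w)
  h-reverse u v []      = refl
  h-reverse u v (x ∷ w) = begin
    h u v (reverse (x ∷ w))                    ≡⟨ cong (h u v) (unfold-reverse x w) ⟩
    h u v (reverse w ++ [ x ])                 ≡⟨ h-++ u v (reverse w) [ x ] ⟩
    h u v (reverse w) ++ h u v [ x ]           ≡⟨ cong₂ _++_ (h-reverse u v w) (sym (reverse-h[x] u v x)) ⟩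
    reverse (h u v w) ++ reverse (h u v [ x ]) ≡⟨ sym (reverse-++ (h u v [ x ]) (h u v w)) ⟩
    reverse (h u v [ x ] ++ h u v w)           ≡⟨ cong reverse (sym (hLetter-++ u v x [] (h u v w))) ⟩
    reverse (h u v (x ∷ w))                    ∎
    where open ≡-Reasoning

  zeros-h : ∀ (u v : Fin m) w → zeros (h u v w) ≡ count u w
  zeros-h u v []      = refl
  zeros-h u v (x ∷ w) with x F.≟ u | x F.≟ v
  ... | yes _ | _     = cong suc (zeros-h u v w)
  ... | no _  | yes _ = zeros-h u v w
  ... | no _  | no _  = zeros-h u v w

  ones-h : ∀ {u v : Fin m} → u ≢ v → ∀ w → ones (h u v w) ≡ count v w
  ones-h u≢v []      = refl
  ones-h {u} {v} u≢v (x ∷ w) with x F.≟ u | x F.≟ v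
  ... | yes refl | yes refl = contradiction refl u≢v
  ... | yes _    | no _     = ones-h u≢v w
  ... | no _     | yes _    = cong suc (ones-h u≢v w)
  ... | no _     | no _     = ones-h u≢v w

  h-head : ∀ {u v : Fin m} {w} → u ≢ v → u ∈ w → v ∈ w →
    (firstIndex u w ℕ.< firstIndex v w × ∃ λ bs → h u v w ≡ false ∷ bs) ⊎
    (firstIndex v w ℕ.< firstIndex u w × ∃ λ bs → h u v w ≡ true ∷ bs)
  h-head {u} {v} {x ∷ w} u≢v u∈ v∈ with x F.≟ u | x F.≟ v
  ... | yes refl | yes refl = contradiction refl u≢v
  ... | yes _    | no _     = inj₁ (s≤s z≤n , _ , refl)
  ... | no _     | yes _    = inj₂ (s≤s z≤n , _ , refl)
  h-head u≢v (here refl) _          | no x≢u | no _   = contradiction refl x≢u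
  h-head u≢v _ (here refl)          | no _   | no x≢v = contradiction refl x≢v
  h-head u≢v (there u∈) (there v∈) | no _   | no _ with h-head u≢v u∈ v∈
  ... | inj₁ (lt , bs , eq) = inj₁ (s≤s lt , bs , eq)
  ... | inj₂ (lt , bs , eq) = inj₂ (s≤s lt , bs , eq)

  h-once : ∀ {u v : Fin m} {xs} → u ≢ v → u ∈ xs → v ∈ xs → count u xs ≡ 1 → count v xs ≡ 1 →
    (firstIndex u xs ℕ.< firstIndex v xs × h u v xs ≡ false ∷ true ∷ []) ⊎
    (firstIndex v xs ℕ.< firstIndex u xs × h u v xs ≡ true ∷ false ∷ [])
  h-once {u} {v} {xs} u≢v u∈ v∈ u-once v-once with h-head u≢v u∈ v∈
  ... | inj₁ (lt , bs , eq) = inj₁ (lt , trans eq (cong (false ∷_) (sole-letter true bs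
          (ℕP.suc-injective (trans (cong zeros (sym eq)) (trans (zeros-h u v xs) u-once)))
          (trans (cong ones (sym eq)) (trans (ones-h u≢v xs) v-once)))))
  ... | inj₂ (lt , bs , eq) = inj₂ (lt , trans eq (cong (true ∷_) (sole-letter false bs
          (ℕP.suc-injective (trans (cong ones (sym eq)) (trans (ones-h u≢v xs) v-once)))
          (trans (cong zeros (sym eq)) (trans (zeros-h u v xs) u-once)))))

  h-tabulate : ∀ {n} {f : Fin n → Fin m} → Injective _≡_ _≡_ f →
    ∀ {a b u v} → f a ≡ u → f b ≡ v → u ≢ v →
    (a F.< b × h u v (tabulate f) ≡ false ∷ true ∷ []) ⊎
    (b F.< a × h u v (tabulate f) ≡ true ∷ false ∷ [])
  h-tabulate f-injective {a} {b} refl refl u≢v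
    with h-once u≢v (∈-tabulate⁺ a) (∈-tabulate⁺ b)
                (count-tabulate f-injective a) (count-tabulate f-injective b)
  ... | inj₁ (lt , eq) =
    inj₁ (subst₂ ℕ._<_ (firstIndex-tabulate f-injective a) (firstIndex-tabulate f-injective b) lt , eq)
  ... | inj₂ (lt , eq) =
    inj₂ (subst₂ ℕ._<_ (firstIndex-tabulate f-injective b) (firstIndex-tabulate f-injective a) lt , eq)

permutationWord : ∀ {n} → Permutation′ n → List (Fin n)
permutationWord {n} π = allFin n ++ tabulate (π ⟨$⟩ˡ_)

permGraph⇔wordGraph : ∀ {n} (π : Permutation′ n) i j →
  PermAdj π i j ⇔ (i ≢ j × L (h i j (permutationWord π)))
permGraph⇔wordGraph {n} π i j with i F.≟ j
... | yes refl = mk⇔ (⊥-elim ∘ irrefl (permGraph π)) (λ (i≢i , _) → contradiction refl i≢i)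
... | no i≢j = mk⇔ (λ adj → i≢j , Equivalence.from L⇔PermAdj adj) (Equivalence.to L⇔PermAdj ∘ proj₂)
  where
  L⇔PermAdj : L (h i j (permutationWord π)) ⇔ PermAdj π i j
  L⇔PermAdj = subst (λ bs → L bs ⇔ PermAdj π i j) (sym (h-++ i j (allFin n) _))
    (L-++-orders (uncurry FP.<-asym) (uncurry FP.<-asym)
      (h-tabulate id refl refl i≢j)
      (h-tabulate (Injection.injective (↔⇒↣ (flip π))) (inverseˡ π) (inverseˡ π) i≢j))

permGraph≅wordGraph : ∀ {n} (π : Permutation′ n) → permGraph π ≅ wordGraph L L-closed (permutationWord π)
permGraph≅wordGraph π = Perm.id , permGraph⇔wordGraph π

module LetterOrder {m} (w : List (Fin m)) (w-complete : ∀ x → x ∈ w) where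

  -- last x is one more than the position of the last occurrence of x in w.
  first firstFromEnd last : Fin m → ℕ
  first x        = firstIndex x w
  firstFromEnd x = firstIndex x (reverse w)
  last x         = length w ∸ firstFromEnd x

  Twice : Fin m → Set
  Twice x = count x w ≡ 2

  twice? : Decidable Twice
  twice? x = count x w ℕ.≟ 2

  ∈-reverse : ∀ x → x ∈ reverse w
  ∈-reverse x = Any.reverse⁺ (w-complete x)

  first<1+len : ∀ x → first x ℕ.< suc (length w)
  first<1+len x = ℕP.m<n⇒m<1+n (firstIndex-< w (w-complete x))

  last<1+len : ∀ x → last x ℕ.< suc (length w)
  last<1+len x = s≤s (ℕP.m∸n≤m (length w) (firstFromEnd x))

  firstFromEnd-< : ∀ x → firstFromEnd x ℕ.< length w
  firstFromEnd-< x =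
    subst (firstFromEnd x ℕ.<_) (length-reverse w) (firstIndex-< (reverse w) (∈-reverse x))

  first-injective : Injective _≡_ _≡_ first
  first-injective = firstIndex-injective (w-complete _) (w-complete _)

  last-injective : Injective _≡_ _≡_ last
  last-injective {x} {y} eq = firstIndex-injective (∈-reverse x) (∈-reverse y)
    (ℕP.∸-cancelˡ-≡ (ℕP.<⇒≤ (firstFromEnd-< x)) (ℕP.<⇒≤ (firstFromEnd-< y)) eq)

  firstFromEnd-<⇒last-> : ∀ {x y} → firstFromEnd x ℕ.< firstFromEnd y → last y ℕ.< last x
  firstFromEnd-<⇒last-> {y = y} lt = ℕP.∸-monoʳ-< lt (ℕP.<⇒≤ (firstFromEnd-< y))

  adjacent⇒twice : ∀ {x y} → x ≢ y → L (h x y w) → Twice x × Twice y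
  adjacent⇒twice {x} {y} x≢y xy∈L with L-balanced xy∈L
  ... | two-zeros , two-ones =
    trans (sym (zeros-h x y w)) two-zeros , trans (sym (ones-h x≢y w)) two-ones

  twice-adjacency : ∀ {x y} → x ≢ y → Twice x → Twice y → L (h x y w) ⇔ Inversion first last x y
  twice-adjacency {x} {y} x≢y x-twice y-twice = L-ends (uncurry ℕP.<-asym) (uncurry ℕP.<-asym)
    (h-head x≢y (w-complete x) (w-complete y)) lastLetter
    (trans (zeros-h x y w) x-twice) (trans (ones-h x≢y w) y-twice)
    where
    lastLetter : (last y ℕ.< last x × ∃ λ cs → reverse (h x y w) ≡ false ∷ cs) ⊎
                 (last x ℕ.< last y × ∃ λ cs → reverse (h x y w) ≡ true ∷ cs)
    lastLetter rewrite sym (h-reverse x y w) with h-head x≢y (∈-reverse x) (∈-reverse y)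
    ... | inj₁ (lt , e) = inj₁ (firstFromEnd-<⇒last-> lt , e)
    ... | inj₂ (lt , e) = inj₂ (firstFromEnd-<⇒last-> lt , e)

  -- Letters not occurring exactly twice are isolated; padding keeps them out of every inversion.
  open Padding twice? (suc (length w))

  wordGraph⇔Inversion : ∀ x y → (x ≢ y × L (h x y w)) ⇔ Inversion (pad first) (pad last) x y
  wordGraph⇔Inversion x y = ⇔-sym (Inversion-pad first<1+len last<1+len x y) ⇔-∘ mk⇔ to from
    where
    to : x ≢ y × L (h x y w) → Twice x × Twice y × Inversion first last x y
    to (x≢y , xy∈L) with adjacent⇒twice x≢y xy∈L
    ... | x-twice , y-twice =
      x-twice , y-twice , Equivalence.to (twice-adjacency x≢y x-twice y-twice) xy∈L
    from : Twice x × Twice y × Inversion first last x y → x ≢ y × L (h x y w)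
    from (x-twice , y-twice , inv) = x≢y , Equivalence.from (twice-adjacency x≢y x-twice y-twice) inv
      where
      x≢y : x ≢ y
      x≢y refl = Inversion-irrefl {k₁ = first} {last} inv

  wordGraph-isPermutationGraph : IsPermutationGraph (wordGraph L L-closed w)
  wordGraph-isPermutationGraph = inversionGraph-isPermutationGraph {G = wordGraph L L-closed w}
    (pad first) (pad last)
    (pad-injective first<1+len first-injective) (pad-injective last<1+len last-injective)
    wordGraph⇔Inversion

in𝒢⇒isPermutationGraph : ∀ {n} {G : Graph n} → In𝒢 L L-closed G → IsPermutationGraph G
in𝒢⇒isPermutationGraph {G = G} (_ , w , _ , w-complete , G≅w) =
  isPermutationGraph-resp-≅ {G = G} {wordGraph L L-closed w} G≅w
    (LetterOrder.wordGraph-isPermutationGraph w w-complete)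

isPermutationGraph⇒in𝒢 : ∀ {n} {G : Graph (suc n)} → IsPermutationGraph G → In𝒢 L L-closed G
isPermutationGraph⇒in𝒢 {n} {G} (π , G≅π) =
  suc n , permutationWord π , (λ ()) , (λ x → ∈-++⁺ˡ (∈-allFin x)) ,
  ≅-trans {G = G} {permGraph π} {wordGraph L L-closed (permutationWord π)} G≅π (permGraph≅wordGraph π)

mainTheorem20 : ∀ (n : ℕ) (G : Graph (suc n)) →
    (In𝒢 L L-closed G ⇔ IsPermutationGraph G)
mainTheorem20 n G = mk⇔ (in𝒢⇒isPermutationGraph {G = G}) (isPermutationGraph⇒in𝒢 {G = G})
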